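{- Let $\mu:G\times H\to K$ be a graph homomorphism, where $K$ is square-free and $G$ is connected and non-bipartite. If $\mu$ has an $H$-extremal set, then $\mu$ can be $H$-improved by recoloring.
   Context: All graphs are finite, simple, loopless; every graph has at least two vertices and no isolated vertices. $G\times H$ is the tensor product (vertices $V(G)\times V(H)$, $(g,h)(g',h')$ an edge iff $gg'\in E(G)$ and $hh'\in E(H)$); for an edge $h_0h_1$ of $H$, $G\times h_0h_1$ is the subgraph induced by $V(G)\times\{h_0,h_1\}$. A graph is square-free if there are no four pairwise distinct vertices $v_1,\dots,v_4$ with $v_1v_2,v_2v_3,v_3v_4,v_4v_1$ edges. For a graph $F$ and $S\subseteq V(F)$, $N_F(S)=\{v:\{u,v\}\in E(F),u\in S\}$ and $N_F^2(S)=N_F(N_F(S))\setminus S$. A homomorphism to $K$ is a $K$-coloring; $\mu$ can be recolored to $\mu^*$ if there is a sequence of $K$-colorings from $\mu$ to $\mu^*$ with consecutive ones differing on at most one vertex. A $K$-coloring $\mu^*$ of $G\times H$ $H$-improves over $\mu$ if the number of triples $(g,g',h)$ with $g,g'\in V(G)$ having a common neighbor in $G$, $h\in V(H)$, and $\mu^*(g,h)\ne\mu^*(g',h)$ is smaller than the corresponding number for $\mu$; $\mu$ can be $H$-improved by recoloring if it can be recolored to some $\mu^*$ that $H$-improves over $\mu$. An $H$-extremal set for $\mu$ is a pair $(S,h_0h_1)$ with $h_0h_1$ an oriented edge of $H$ and $S\subseteq V(G)\times\{h_1\}$ such that, for some $a,b\in V(K)$, $\mu(S)=\{a\}$, $\mu(N_{G\times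 h_0h_1}(S))=\{b\}$, $N^2_{G\times h_0h_1}(S)\neq\emptyset$ and $a\notin\mu(N^2_{G\times h_0h_1}(S))$. -}

module Defs where

open import Data.Nat using (ℕ; _≤_; _<_; _+_)
open import Data.Fin using (Fin; _≟_)
open import Data.Bool using (Bool; true; false; _∧_; not; if_then_else_)
open import Data.Product using (Σ; ∃; ∃-syntax; _×_; _,_; proj₁; proj₂)
open import Data.Sum using (_⊎_)
open import Data.Empty using (⊥)
open import Relation.Nullary using (¬_)
open import Relation.Nullary.Decidable using (⌊_⌋)
open import Relation.Binary.PropositionalEquality using (_≡_; _≢_)

record Graph : Set where
  field
    n       : ℕ
    adj     : Fin n → Fin n → Bool
    sym     : ∀ u v → adj u v ≡ true → adj v u ≡ true
    loopless : ∀ v → adj v v ≡ false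
    twoVerts : 2 ≤ n
    noIsolated : ∀ v → ∃[ u ] adj v u ≡ true

open Graph public

V : Graph → Set
V G = Fin (n G)

Adj : (G : Graph) → V G → V G → Set
Adj G u v = adj G u v ≡ true

data Walk (G : Graph) : V G → V G → Set where
  here : ∀ {v} → Walk G v v
  step : ∀ {u w v} → Adj G u w → Walk G w v → Walk G u v

Connected : Graph → Set
Connected G = ∀ u v → Walk G u v

Bipartite : Graph → Set
Bipartite G = Σ (V G → Bool) λ c → ∀ u v → Adj G u v → c u ≢ c v

SquareFree : Graph → Set
SquareFree K = ∀ (v₁ v₂ v₃ v₄ : V K) →
  v₁ ≢ v₂ → v₁ ≢ v₃ → v₁ ≢ v₄ → v₂ ≢ v₃ → v₂ ≢ v₄ → v₃ ≢ v₄ →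
  Adj K v₁ v₂ → Adj K v₂ v₃ → Adj K v₃ v₄ → Adj K v₄ v₁ → ⊥

VT : Graph → Graph → Set
VT G H = V G × V H

AdjT : (G H : Graph) → VT G H → VT G H → Set
AdjT G H (g , h) (g' , h') = Adj G g g' × Adj H h h'

IsHom : (G H K : Graph) → (VT G H → V K) → Set
IsHom G H K μ = ∀ u v → AdjT G H u v → Adj K (μ u) (μ v)

DifferAtMostOne : (G H K : Graph) → (VT G H → V K) → (VT G H → V K) → Set
DifferAtMostOne G H K μ ν = ∃[ x ] (∀ y → y ≢ x → μ y ≡ ν y)

data Recolor (G H K : Graph) : (VT G H → V K) → (VT G H → V K) → Set where
  done : ∀ {μ} → Recolor G H K μ μ
  move : ∀ {μ ν μ*} → IsHom G H K ν → DifferAtMostOne G H K μ ν →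
         Recolor G H K ν μ* → Recolor G H K μ μ*

ΣFin : (m : ℕ) → (Fin m → ℕ) → ℕ
ΣFin ℕ.zero f = 0
ΣFin (ℕ.suc m) f = f Fin.zero + ΣFin m (λ i → f (Fin.suc i))

anyFin : (m : ℕ) → (Fin m → Bool) → Bool
anyFin ℕ.zero f = false
anyFin (ℕ.suc m) f = if f Fin.zero then true else anyFin m (λ i → f (Fin.suc i))

commonNbr : (G : Graph) → V G → V G → Bool
commonNbr G g g' = anyFin (n G) (λ x → adj G g x ∧ adj G g' x)

badCount : (G H K : Graph) → (VT G H → V K) → ℕ
badCount G H K μ =
  ΣFin (n G) λ g → ΣFin (n G) λ g' → ΣFin (n H) λ h →
    if commonNbr G g g' ∧ not ⌊ μ (g , h) ≟ μ (g' , h) ⌋ then 1 else 0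

HImproves : (G H K : Graph) → (μ* μ : VT G H → V K) → Set
HImproves G H K μ* μ = badCount G H K μ* < badCount G H K μ

HImprovableByRecoloring : (G H K : Graph) → (VT G H → V K) → Set
HImprovableByRecoloring G H K μ =
  Σ (VT G H → V K) λ μ* → IsHom G H K μ* × Recolor G H K μ μ* × HImproves G H K μ* μ

-- Vertex sets of G × H as predicates.  The induced subgraph G × h₀h₁ has
-- vertex set V G × {h₀, h₁}.
InLayers : (G H : Graph) → V H → V H → VT G H → Set
InLayers G H h₀ h₁ (g , h) = h ≡ h₀ ⊎ h ≡ h₁

Nbr : (G H : Graph) → V H → V H → (VT G H → Set) → VT G H → Set
Nbr G H h₀ h₁ S v =
  InLayers G H h₀ h₁ v × ∃[ u ] (S u × InLayers G H h₀ h₁ u × AdjT G H u v)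

Nbr2 : (G H : Graph) → V H → V H → (VT G H → Set) → VT G H → Set
Nbr2 G H h₀ h₁ S v = Nbr G H h₀ h₁ (Nbr G H h₀ h₁ S) v × ¬ S v

Layer : (G H : Graph) → V H → (V G → Bool) → VT G H → Set
Layer G H h₁ s (g , h) = h ≡ h₁ × s g ≡ true

IsHExtremal : (G H K : Graph) → (VT G H → V K) → V H → V H → (V G → Bool) → Set
IsHExtremal G H K μ h₀ h₁ s =
  Adj H h₀ h₁ ×
  Σ (V K) λ a → Σ (V K) λ b →
    ((∃[ v ] S v) × (∀ v → S v → μ v ≡ a)) ×
    ((∃[ v ] Nbr G H h₀ h₁ S v) × (∀ v → Nbr G H h₀ h₁ S v → μ v ≡ b)) ×
    (∃[ v ] Nbr2 G H h₀ h₁ S v) ×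
    (∀ v → Nbr2 G H h₀ h₁ S v → μ v ≢ a)
  where
    S = Layer G H h₁ s

HasHExtremalSet : (G H K : Graph) → (VT G H → V K) → Set
HasHExtremalSet G H K μ =
  Σ (V H) λ h₀ → Σ (V H) λ h₁ → Σ (V G → Bool) λ s → IsHExtremal G H K μ h₀ h₁ s

module Submission where

-- An H-extremal set (S, h₀h₁) is handled in G-terms: S = s × {h₁} is coloured
-- a, its G-neighbours in layer h₀ are coloured b, and every vertex q ∉ s of
-- layer h₁ reached from s by a G-walk of length two avoids the colour a.
-- We argue by well-founded induction on |s| + |N_G(s)|.
--
--  * Terminal case: every neighbour of S in G × H is coloured b.  Then
--    recolouring S with c = μ(q₀, h₁), for a q₀ at distance two from s, is a
--    homomorphism; since S lies in one (independent) layer it is reached one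
--    vertex at a time, and it removes the conflict between S and q₀ without
--    creating new ones.
--  * Descent: some neighbour (y, h) of S has a colour d ≠ b.  Square-freeness
--    of K pins the colour b on every neighbour of S having a neighbour outside
--    s, so W = {w : N_G(w) ⊆ s, μ(w, h) = d} × {h} is again extremal for the
--    edge h₁h; it leaves W by a two-step walk because G is connected and not
--    bipartite, and |W| + |N_G(W)| < |s| + |N_G(s)|.

open import Defs
open import Relation.Nullary using (¬_; Dec; yes; no)
open import Relation.Nullary.Decidable using (⌊_⌋; _×-dec_; ¬?; decidable-stable)
open import Relation.Binary.PropositionalEquality using (_≡_; _≢_; refl; trans; cong; cong₂; subst; subst₂) renaming (sym to ≡-sym)
open import Data.Nat using (ℕ; zero; suc; _+_; _≤_; _<_; _<ᵇ_; z≤n; s≤s) renaming (_≟_ to _≟ℕ_)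
open import Data.Nat.Properties using (≤-refl; ≤-reflexive; ≤-<-trans; <⇒≤; <⇒<ᵇ; +-mono-≤; +-mono-<-≤; +-mono-≤-<; +-comm)
open import Data.Nat.Induction using (<-wellFounded)
open import Induction.WellFounded using (Acc; acc)
open import Data.Fin using (Fin; toℕ; fromℕ<; _≟_)
open import Data.Fin.Properties using (any?; toℕ-injective; toℕ<n; toℕ-fromℕ<)
open import Data.Bool using (Bool; true; false; _∧_; not; if_then_else_)
open import Data.Bool.Properties using (T-≡; ¬-not) renaming (_≟_ to _≟B_)
open import Data.Product using (∃; _×_; _,_; proj₁; proj₂)
open import Data.Sum using (_⊎_; inj₁; inj₂)
open import Data.Empty using (⊥; ⊥-elim)
open import Function.Bundles using (Equivalence)

does-true : ∀ {P : Set} (d : Dec P) → ⌊ d ⌋ ≡ true → P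
does-true (yes p) _ = p
does-true (no _) ()

does-false : ∀ {P : Set} (d : Dec P) → ⌊ d ⌋ ≡ false → ¬ P
does-false (yes _) ()
does-false (no ¬p) _ = ¬p

decided-true : ∀ {P : Set} (d : Dec P) → P → ⌊ d ⌋ ≡ true
decided-true (yes _) _ = refl
decided-true (no ¬p) p = ⊥-elim (¬p p)

decided-false : ∀ {P : Set} (d : Dec P) → ¬ P → ⌊ d ⌋ ≡ false
decided-false (yes p) ¬p = ⊥-elim (¬p p)
decided-false (no _) _ = refl

true≢false : ∀ {x : Bool} → x ≡ true → x ≡ false → ⊥
true≢false refl ()

∧-split : ∀ {x y : Bool} → x ∧ y ≡ true → x ≡ true × y ≡ true
∧-split {true} {true} refl = refl , refl

ΣFin-mono : ∀ m {f f' : Fin m → ℕ} → (∀ i → f i ≤ f' i) → ΣFin m f ≤ ΣFin m f'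
ΣFin-mono zero le = z≤n
ΣFin-mono (suc m) le = +-mono-≤ (le Fin.zero) (ΣFin-mono m (λ i → le (Fin.suc i)))

ΣFin-strict : ∀ m {f f' : Fin m → ℕ} → (∀ i → f i ≤ f' i) →
              ∀ i → f i < f' i → ΣFin m f < ΣFin m f'
ΣFin-strict (suc m) le Fin.zero lt = +-mono-<-≤ lt (ΣFin-mono m (λ i → le (Fin.suc i)))
ΣFin-strict (suc m) le (Fin.suc i) lt =
  +-mono-≤-< (le Fin.zero) (ΣFin-strict m (λ j → le (Fin.suc j)) i lt)

count : (m : ℕ) → (Fin m → Bool) → ℕ
count m p = ΣFin m (λ i → if p i then 1 else 0)

indicator-mono : ∀ p q → (p ≡ true → q ≡ true) → (if p then 1 else 0) ≤ (if q then 1 else 0)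
indicator-mono false q _ = z≤n
indicator-mono true q p⇒q rewrite p⇒q refl = ≤-refl

indicator-strict : ∀ {p q} → p ≡ false → q ≡ true → (if p then 1 else 0) < (if q then 1 else 0)
indicator-strict refl refl = s≤s z≤n

count-mono : ∀ m {p q : Fin m → Bool} → (∀ i → p i ≡ true → q i ≡ true) → count m p ≤ count m q
count-mono m {p} {q} p⊆q = ΣFin-mono m (λ i → indicator-mono (p i) (q i) (p⊆q i))

count-strict : ∀ m {p q : Fin m → Bool} → (∀ i → p i ≡ true → q i ≡ true) →
               ∀ i → p i ≡ false → q i ≡ true → count m p < count m q
count-strict m {p} {q} p⊆q i pi qi =
  ΣFin-strict m (λ j → indicator-mono (p j) (q j) (p⊆q j)) i (indicator-strict pi qi)

anyFin-intro : ∀ m (f : Fin m → Bool) i → f i ≡ true → anyFin m f ≡ true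
anyFin-intro (suc m) f Fin.zero fi with f Fin.zero
... | true = refl
anyFin-intro (suc m) f (Fin.suc i) fi with f Fin.zero
... | true = refl
... | false = anyFin-intro m (λ j → f (Fin.suc j)) i fi

anyFin-elim : ∀ m (f : Fin m → Bool) → anyFin m f ≡ true → ∃ λ i → f i ≡ true
anyFin-elim (suc m) f any with f Fin.zero in f0
... | true = Fin.zero , f0
... | false with anyFin-elim m (λ j → f (Fin.suc j)) any
... | i , fi = Fin.suc i , fi

adj-sym : (X : Graph) {u v : V X} → Adj X u v → Adj X v u
adj-sym X {u} {v} = sym X u v

adj-irrefl : (X : Graph) {u v : V X} → Adj X u v → u ≢ v
adj-irrefl X {u} uu refl = true≢false uu (loopless X u)

commonNbr-intro : (G : Graph) {g g' x : V G} → Adj G g x → Adj G g' x → commonNbr G g g' ≡ true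
commonNbr-intro G {x = x} gx g'x = anyFin-intro (n G) _ x (cong₂ _∧_ gx g'x)

commonNbr-elim : (G : Graph) {g g' : V G} → commonNbr G g g' ≡ true →
                 ∃ λ x → Adj G g x × Adj G g' x
commonNbr-elim G cn with anyFin-elim (n G) _ cn
... | x , both = x , ∧-split both

commonNbr-sym : (G : Graph) {g g' : V G} → commonNbr G g g' ≡ true → commonNbr G g' g ≡ true
commonNbr-sym G cn with commonNbr-elim G cn
... | x , gx , g'x = commonNbr-intro G g'x gx

nbr : (G : Graph) → (V G → Bool) → V G → Bool
nbr G s v = ⌊ any? (λ x → (s x ≟B true) ×-dec (adj G x v ≟B true)) ⌋

weight : (G : Graph) → (V G → Bool) → ℕ
weight G s = count (n G) s + count (n G) (nbr G s)

nbr-intro : (G : Graph) {s : V G → Bool} {x v : V G} → s x ≡ true → Adj G x v → nbr G s v ≡ true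
nbr-intro G {x = x} sx xv = decided-true (any? _) (x , sx , xv)

nbr-elim : (G : Graph) {s : V G → Bool} {v : V G} → nbr G s v ≡ true → ∃ λ x → s x ≡ true × Adj G x v
nbr-elim G = does-true (any? _)

squareFree-diagonal : (K : Graph) → SquareFree K → {A B C D : V K} →
  Adj K A B → Adj K B C → Adj K C D → Adj K D A → A ≢ C → B ≡ D
squareFree-diagonal K sqf {A} {B} {C} {D} AB BC CD DA A≢C with B ≟ D
... | yes B≡D = B≡D
... | no B≢D = ⊥-elim (sqf A B C D (adj-irrefl K AB) A≢C (λ A≡D → adj-irrefl K DA (≡-sym A≡D))
                          (adj-irrefl K BC) B≢D (adj-irrefl K CD) AB BC CD DA)

record TwoStepExit (G : Graph) (W : V G → Bool) : Set where
  constructor exitVia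
  field
    inner middle outer : V G
    inner∈ : W inner ≡ true
    inner~middle : Adj G inner middle
    middle~outer : Adj G middle outer
    outer∉ : W outer ≡ false

module Connectivity (G : Graph) (conn : Connected G) where

  spread : (P : V G → Set) → (∀ {t t'} → Adj G t t' → P t → P t') → ∀ {u} → P u → ∀ v → P v
  spread P along {u} pu v = walk (conn u v) pu
    where
      walk : ∀ {t t'} → Walk G t t' → P t → P t'
      walk here p = p
      walk (step tt' rest) p = walk rest (along tt' p)

  Closed2 : (V G → Bool) → Set
  Closed2 W = ∀ {w x w'} → W w ≡ true → Adj G w x → Adj G x w' → W w' ≡ true

  -- In a connected non-bipartite graph a nonempty set closed under walks of
  -- length two is everything: if it contains an edge it spreads along every
  -- walk, and otherwise it would be one side of a bipartition.
  closed2-total : ¬ Bipartite G → ∀ {W u} → Closed2 W → W u ≡ true → ∀ v → W v ≡ true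
  closed2-total nbip {W} {u} closed wu
    with any? (λ x → any? (λ z → (W x ≟B true) ×-dec ((W z ≟B true) ×-dec (adj G x z ≟B true))))
  ... | yes (x , z , wx , wz , xz) = λ v → proj₁ (spread InWithNbr extend (wx , z , wz , xz) v)
    where
      InWithNbr : V G → Set
      InWithNbr t = W t ≡ true × ∃ λ w → W w ≡ true × Adj G t w

      extend : ∀ {t t'} → Adj G t t' → InWithNbr t → InWithNbr t'
      extend {t} tt' (wt , w , ww , tw) = closed ww (adj-sym G tw) tt' , t , wt , adj-sym G tt'
  ... | no noEdge = ⊥-elim (nbip (W , proper))
    where
      InOrNextTo : V G → Set
      InOrNextTo t = W t ≡ true ⊎ ∃ λ w → W w ≡ true × Adj G w t

      alternate : ∀ {t t'} → Adj G t t' → InOrNextTo t → InOrNextTo t'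
      alternate {t} tt' (inj₁ wt) = inj₂ (t , wt , tt')
      alternate tt' (inj₂ (w , ww , wt)) = inj₁ (closed ww wt tt')

      proper : ∀ t t' → Adj G t t' → W t ≢ W t'
      proper t t' tt' eq with spread InOrNextTo alternate (inj₁ wu) t
      ... | inj₁ wt = noEdge (t , t' , wt , trans (≡-sym eq) wt , tt')
      ... | inj₂ (w , ww , wt) = noEdge (t , t' , trans eq wt' , wt' , tt')
        where wt' = closed ww wt tt'

  twoStepExit : ¬ Bipartite G → ∀ {W u v} → W u ≡ true → W v ≡ false → TwoStepExit G W
  twoStepExit nbip {W} {u} {v} wu wv
    with any? (λ w → any? (λ x → any? (λ w' → (W w ≟B true) ×-dec ((adj G w x ≟B true) ×-dec
                                                ((adj G x w' ≟B true) ×-dec (W w' ≟B false))))))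
  ... | yes (w , x , w' , ww , wx , xw' , w'∉) = exitVia w x w' ww wx xw' w'∉
  ... | no noExit = ⊥-elim (true≢false (closed2-total nbip closed wu v) wv)
    where
      closed : Closed2 W
      closed {w} {x} {w'} ww wx xw' with W w' in w'∈
      ... | true = refl
      ... | false = ⊥-elim (noExit (w , x , w' , ww , wx , xw' , w'∈))

Recolor-snoc : ∀ {G H K : Graph} {μ ρ σ} → Recolor G H K μ ρ → IsHom G H K σ →
               DifferAtMostOne G H K ρ σ → Recolor G H K μ σ
Recolor-snoc done σ-hom ρσ = move σ-hom ρσ done
Recolor-snoc (move ν-hom μν r) σ-hom ρσ = move ν-hom μν (Recolor-snoc r σ-hom ρσ)

<ᵇ-suc : ∀ m k → m ≢ k → (m <ᵇ k) ≡ (m <ᵇ suc k)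
<ᵇ-suc zero zero m≢k = ⊥-elim (m≢k refl)
<ᵇ-suc zero (suc k) _ = refl
<ᵇ-suc (suc m) zero _ = refl
<ᵇ-suc (suc m) (suc k) m≢k = <ᵇ-suc m k (λ m≡k → m≢k (cong suc m≡k))

module LayerRecolouring (G H K : Graph) (h₁ : V H) where

  AgreeOffLayer : (μ ν : VT G H → V K) → Set
  AgreeOffLayer μ ν = ∀ g h → h ≢ h₁ → μ (g , h) ≡ ν (g , h)

  mix : (VT G H → Bool) → (μ ν : VT G H → V K) → VT G H → V K
  mix sel μ ν v = if sel v then ν v else μ v

  mix-agree : ∀ sel {μ ν : VT G H → V K} v → μ v ≡ ν v → mix sel μ ν v ≡ μ v
  mix-agree sel v μv≡νv with sel v
  ... | true = ≡-sym μv≡νv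
  ... | false = refl

  module _ {μ ν : VT G H → V K} (μ-hom : IsHom G H K μ) (ν-hom : IsHom G H K ν)
           (agree : AgreeOffLayer μ ν) where

    -- An edge of G × H has at most one end in the layer, so its two ends may
    -- be coloured one by μ and the other by ν.
    cross : ∀ {g g' h h'} → AdjT G H (g , h) (g' , h') → Adj K (ν (g , h)) (μ (g' , h'))
    cross {g} {g'} {h} {h'} e@(_ , hh') with h ≟ h₁
    ... | yes refl = subst (Adj K _) (≡-sym (agree g' h' (λ h'≡h → adj-irrefl H hh' (≡-sym h'≡h))))
                           (ν-hom _ _ e)
    ... | no h≢h₁ = subst (λ x → Adj K x _) (agree g h h≢h₁) (μ-hom _ _ e)

    mix-hom : ∀ sel → IsHom G H K (mix sel μ ν)
    mix-hom sel (g , h) (g' , h') e@(gg' , hh') with sel (g , h) | sel (g' , h')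
    ... | true | true = ν-hom _ _ e
    ... | true | false = cross e
    ... | false | true = adj-sym K (cross (adj-sym G gg' , adj-sym H hh'))
    ... | false | false = μ-hom _ _ e

    below : ℕ → VT G H → Bool
    below k v = toℕ (proj₁ v) <ᵇ k

    interpolate : ℕ → VT G H → V K
    interpolate k = mix (below k) μ ν

    interpolate-step : ∀ {k} (k<n : k < n G) → ∀ v → v ≢ (fromℕ< k<n , h₁) →
                       interpolate k v ≡ interpolate (suc k) v
    interpolate-step {k} k<n (g , h) v≢ with toℕ g ≟ℕ k
    ... | no toℕg≢k = cong (λ b → if b then ν (g , h) else μ (g , h)) (<ᵇ-suc (toℕ g) k toℕg≢k)
    ... | yes toℕg≡k = trans (mix-agree (below k) {μ} {ν} (g , h) off)
                               (≡-sym (mix-agree (below (suc k)) {μ} {ν} (g , h) off))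
      where
        g≡k : g ≡ fromℕ< k<n
        g≡k = toℕ-injective (trans toℕg≡k (≡-sym (toℕ-fromℕ< k<n)))
        off : μ (g , h) ≡ ν (g , h)
        off = agree g h (λ h≡h₁ → v≢ (cong₂ _,_ g≡k h≡h₁))

    interpolate-recolor : ∀ k → k ≤ n G → Recolor G H K μ (interpolate k)
    interpolate-recolor zero _ = done
    interpolate-recolor (suc k) k<n =
      Recolor-snoc (interpolate-recolor k (<⇒≤ k<n)) (mix-hom _)
                   ((fromℕ< k<n , h₁) , interpolate-step k<n)

    interpolate-complete : ∀ v → interpolate (n G) v ≡ ν v
    interpolate-complete (g , h) =
      cong (λ b → if b then ν (g , h) else μ (g , h)) (Equivalence.to T-≡ (<⇒<ᵇ (toℕ<n g)))

open LayerRecolouring using (AgreeOffLayer; interpolate; interpolate-recolor; interpolate-complete; mix-hom)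

clash : {k : ℕ} → Bool → Fin k → Fin k → ℕ
clash cb x y = if cb ∧ not ⌊ x ≟ y ⌋ then 1 else 0

Clash : {k : ℕ} → Bool → Fin k → Fin k → Set
Clash cb x y = cb ≡ true × x ≢ y

clash-one : ∀ {k} {cb} {x y : Fin k} → Clash cb x y → clash cb x y ≡ 1
clash-one {x = x} {y} (refl , x≢y) with x ≟ y
... | yes x≡y = ⊥-elim (x≢y x≡y)
... | no _ = refl

clash-zero : ∀ {k} {cb} {x y : Fin k} → ¬ Clash cb x y → clash cb x y ≡ 0
clash-zero {cb = false} _ = refl
clash-zero {cb = true} {x} {y} ¬c with x ≟ y
... | yes _ = refl
... | no x≢y = ⊥-elim (¬c (refl , x≢y))

clash-mono : ∀ {k} {cb cb'} {x y x' y' : Fin k} → (Clash cb x y → Clash cb' x' y') →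
             clash cb x y ≤ clash cb' x' y'
clash-mono {cb = cb} {x = x} {y} implies with (cb ≟B true) ×-dec ¬? (x ≟ y)
... | yes c = ≤-reflexive (trans (clash-one c) (≡-sym (clash-one (implies c))))
... | no ¬c = subst (_≤ _) (≡-sym (clash-zero ¬c)) z≤n

clash-strict : ∀ {k} {cb cb'} {x y x' y' : Fin k} → ¬ Clash cb x y → Clash cb' x' y' →
               clash cb x y < clash cb' x' y'
clash-strict ¬c c' = subst₂ _<_ (≡-sym (clash-zero ¬c)) (≡-sym (clash-one c')) (s≤s z≤n)

module Conflicts (G H K : Graph) where

  Conflict : (VT G H → V K) → V G → V G → V H → Set
  Conflict μ g g' h = Clash (commonNbr G g g') (μ (g , h)) (μ (g' , h))

  FewerConflicts : (ν μ : VT G H → V K) → Set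
  FewerConflicts ν μ = ∀ g g' h → Conflict ν g g' h → Conflict μ g g' h

  badCount-mono : ∀ {ν μ} → FewerConflicts ν μ → badCount G H K ν ≤ badCount G H K μ
  badCount-mono sub =
    ΣFin-mono (n G) λ g → ΣFin-mono (n G) λ g' → ΣFin-mono (n H) λ h → clash-mono (sub g g' h)

  badCount-strict : ∀ {ν μ} → FewerConflicts ν μ → ∀ g g' h →
                    ¬ Conflict ν g g' h → Conflict μ g g' h → badCount G H K ν < badCount G H K μ
  badCount-strict sub g g' h ¬cν cμ =
    ΣFin-strict (n G) (λ g → ΣFin-mono (n G) λ g' → ΣFin-mono (n H) λ h → clash-mono (sub g g' h)) g
      (ΣFin-strict (n G) (λ g' → ΣFin-mono (n H) λ h → clash-mono (sub g g' h)) g'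
        (ΣFin-strict (n H) (λ h → clash-mono (sub g g' h)) h (clash-strict ¬cν cμ)))

  pointwise-fewer : ∀ {ρ ν} → (∀ v → ρ v ≡ ν v) → FewerConflicts ρ ν
  pointwise-fewer ρ≡ν g g' h (cn , ρ≢) = cn , λ ν≡ → ρ≢ (trans (ρ≡ν (g , h)) (trans ν≡ (≡-sym (ρ≡ν (g' , h)))))

open Conflicts using (Conflict; FewerConflicts; badCount-mono; badCount-strict; pointwise-fewer)

-- A homomorphism that changes μ only on one layer and H-improves it is
-- reachable by recolouring (up to pointwise equality, which badCount respects).
improvable-by-layer : (G H K : Graph) {h₁ : V H} {μ ν : VT G H → V K} →
  IsHom G H K μ → IsHom G H K ν → AgreeOffLayer G H K h₁ μ ν → HImproves G H K ν μ →
  HImprovableByRecoloring G H K μ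
improvable-by-layer G H K {h₁} μ-hom ν-hom agree better =
  interpolate G H K h₁ μ-hom ν-hom agree (n G) ,
  mix-hom G H K h₁ μ-hom ν-hom agree _ ,
  interpolate-recolor G H K h₁ μ-hom ν-hom agree (n G) ≤-refl ,
  ≤-<-trans (badCount-mono G H K (pointwise-fewer G H K (interpolate-complete G H K h₁ μ-hom ν-hom agree)))
            better

module LayerNeighbourhoods (G H : Graph) {h₀ h₁ : V H} (h₀h₁ : Adj H h₀ h₁) {s : V G → Bool} where

  S : VT G H → Set
  S = Layer G H h₁ s

  layerNbr : ∀ {g y} → s g ≡ true → Adj G g y → Nbr G H h₀ h₁ S (y , h₀)
  layerNbr {g} sg gy = inj₁ refl , (g , h₁) , (refl , sg) , inj₂ refl , (gy , adj-sym H h₀h₁)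

  layerNbr2 : (p : TwoStepExit G s) → Nbr2 G H h₀ h₁ S (TwoStepExit.outer p , h₁)
  layerNbr2 (exitVia g x q sg gx xq q∉) =
    (inj₂ refl , (x , h₀) , layerNbr sg gx , inj₁ refl , (xq , h₀h₁)) , λ (_ , q∈) → true≢false q∈ q∉

  layerExit : ∀ v → Nbr2 G H h₀ h₁ S v → TwoStepExit G s
  layerExit (q , hq) ((q-in , (x , hx) , (x-in , (g , _) , (refl , sg) , _ , (gx , h₁hx)) , _ , (xq , hxhq)) , q∉S)
    with x-in
  ... | inj₂ refl = ⊥-elim (adj-irrefl H h₁hx refl)
  ... | inj₁ refl with q-in
  ... | inj₁ refl = ⊥-elim (adj-irrefl H hxhq refl)
  ... | inj₂ refl = exitVia g x q sg gx xq (¬-not (λ q∈ → q∉S (refl , q∈)))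

module ExtremalSets (G H K : Graph) (μ : VT G H → V K) where

  record Extremal (h₀ h₁ : V H) (s : V G → Bool) : Set where
    field
      edge : Adj H h₀ h₁
      a b : V K
      colour-a : ∀ {g} → s g ≡ true → μ (g , h₁) ≡ a
      colour-b : ∀ {g y} → s g ≡ true → Adj G g y → μ (y , h₀) ≡ b
      exit : TwoStepExit G s
      avoid-a : (p : TwoStepExit G s) → μ (TwoStepExit.outer p , h₁) ≢ a

  fromHExtremal : ∀ {h₀ h₁ s} → IsHExtremal G H K μ h₀ h₁ s → Extremal h₀ h₁ s
  fromHExtremal (h₀h₁ , a , b , (_ , on-S) , (_ , on-N) , (v , v∈N²) , off-N²) = record
    { edge = h₀h₁ ; a = a ; b = b
    ; colour-a = λ sg → on-S _ (refl , sg)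
    ; colour-b = λ sg gy → on-N _ (layerNbr sg gy)
    ; exit = layerExit v v∈N²
    ; avoid-a = λ p → off-N² _ (layerNbr2 p)
    }
    where open LayerNeighbourhoods G H h₀h₁

  module _ (hom : IsHom G H K μ) where

    module Terminal {h₀ h₁ s} (e : Extremal h₀ h₁ s)
                    (all-b : ∀ {g y h} → s g ≡ true → Adj G g y → Adj H h₁ h → μ (y , h) ≡ Extremal.b e)
                    where
      open Extremal e
      open TwoStepExit exit

      c : V K
      c = μ (outer , h₁)

      -- c is adjacent to b since (middle, h₀) — coloured b — is adjacent to (outer, h₁).
      b~c : Adj K b c
      b~c = subst (λ x → Adj K x c) (colour-b inner∈ inner~middle) (hom _ _ (middle~outer , edge))

      inS? : (v : VT G H) → Dec (Layer G H h₁ s v)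
      inS? (g , h) = (h ≟ h₁) ×-dec (s g ≟B true)

      ν : VT G H → V K
      ν v = if ⌊ inS? v ⌋ then c else μ v

      -- The neighbours of S all carry b, which is adjacent to c.
      ν-hom : IsHom G H K ν
      ν-hom (g , h) (g' , h') uv@(gg' , hh') with inS? (g , h) | inS? (g' , h')
      ... | yes (refl , _) | yes (refl , _) = ⊥-elim (adj-irrefl H hh' refl)
      ... | yes (refl , sg) | no _ = subst (Adj K c) (≡-sym (all-b sg gg' hh')) (adj-sym K b~c)
      ... | no _ | yes (refl , sg') =
            subst (λ x → Adj K x c) (≡-sym (all-b sg' (adj-sym G gg') (adj-sym H hh'))) b~c
      ... | no _ | no _ = hom _ _ uv

      agree : AgreeOffLayer G H K h₁ μ ν
      agree g h h≢h₁ with inS? (g , h)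
      ... | yes (h≡h₁ , _) = ⊥-elim (h≢h₁ h≡h₁)
      ... | no _ = refl

      -- Vertices of layer h₁ inside and outside s with a common neighbour
      -- have different colours, as the outer one lies in N²(S).
      separated : ∀ {g g'} → s g ≡ true → s g' ≡ false → commonNbr G g g' ≡ true →
                  μ (g , h₁) ≢ μ (g' , h₁)
      separated sg sg' cn eq with commonNbr-elim G cn
      ... | x , gx , g'x = avoid-a (exitVia _ x _ sg gx (adj-sym G g'x) sg') (trans (≡-sym eq) (colour-a sg))

      -- Recolouring S creates no conflict: within S all colours are now c,
      -- and pairs across the boundary of S were already in conflict.
      fewer : FewerConflicts G H K ν μ
      fewer g g' h (cn , ν≢) with inS? (g , h) | inS? (g' , h)
      ... | yes _ | yes _ = ⊥-elim (ν≢ refl)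
      ... | yes (refl , sg) | no out = cn , separated sg (¬-not (λ sg' → out (refl , sg'))) cn
      ... | no out | yes (refl , sg') =
            cn , λ eq → separated sg' (¬-not (λ sg → out (refl , sg))) (commonNbr-sym G cn) (≡-sym eq)
      ... | no _ | no _ = cn , ν≢

      resolved : ¬ Conflict G H K ν inner outer h₁
      resolved (_ , ν≢) with inS? (inner , h₁) | inS? (outer , h₁)
      ... | yes _ | no _ = ν≢ refl
      ... | no out | _ = out (refl , inner∈)
      ... | yes _ | yes (_ , outer∈) = true≢false outer∈ outer∉

      present : Conflict G H K μ inner outer h₁
      present = cn , separated inner∈ outer∉ cn
        where cn = commonNbr-intro G inner~middle (adj-sym G middle~outer)

      result : HImprovableByRecoloring G H K μ
      result = improvable-by-layer G H K hom ν-hom agree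
                 (badCount-strict G H K fewer inner outer h₁ resolved present)

    module _ (sqf : SquareFree K) (conn : Connected G) (nbip : ¬ Bipartite G) where
      open Connectivity G conn using (twoStepExit)

      module Descent {h₀ h₁ s} (e : Extremal h₀ h₁ s) {g y h} (sg : s g ≡ true) (gy : Adj G g y)
                     (h₁h : Adj H h₁ h) (d≢b : μ (y , h) ≢ Extremal.b e) where
        open Extremal e
        open TwoStepExit exit

        d : V K
        d = μ (y , h)

        -- Square-freeness pins the colour b on every neighbour w of s that has
        -- a neighbour outside s, in every layer adjacent to h₁: the 4-cycle
        -- (x,h₁) (w,h₀) (z,h₁) (w,h') has distinct colours at (x,h₁), (z,h₁).
        pinned : ∀ {x w z h'} → s x ≡ true → Adj G x w → Adj G w z → s z ≡ false →
                 Adj H h₁ h' → μ (w , h') ≡ b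
        pinned {x} {w} {z} {h'} sx xw wz z∉ h₁h' =
          trans (≡-sym diagonal) (colour-b sx xw)
          where
            diagonal : μ (w , h₀) ≡ μ (w , h')
            diagonal = squareFree-diagonal K sqf
              (hom _ _ (xw , adj-sym H edge)) (hom _ _ (wz , edge))
              (hom _ _ (adj-sym G wz , h₁h')) (hom _ _ (adj-sym G xw , adj-sym H h₁h'))
              (λ x≡z → avoid-a (exitVia x w z sx xw wz z∉) (trans (≡-sym x≡z) (colour-a sx)))

        Escapes : V G → Set
        Escapes w = ∃ λ z → Adj G w z × s z ≡ false

        escapes? : ∀ w → Dec (Escapes w)
        escapes? w = any? (λ z → (adj G w z ≟B true) ×-dec (s z ≟B false))

        nbrs-in-s : ∀ {w z} → ¬ Escapes w → Adj G w z → s z ≡ true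
        nbrs-in-s ¬esc wz = ¬-not (λ z∉ → ¬esc (_ , wz , z∉))

        InW : V G → Set
        InW w = ¬ Escapes w × μ (w , h) ≡ d

        W : V G → Bool
        W w = ⌊ ¬? (escapes? w) ×-dec (μ (w , h) ≟ d) ⌋

        W-sound : ∀ {w} → W w ≡ true → InW w
        W-sound {w} = does-true (¬? (escapes? w) ×-dec (μ (w , h) ≟ d))

        W-escapes : ∀ {w} → W w ≡ false → μ (w , h) ≡ d → Escapes w
        W-escapes {w} w∉ μw≡d =
          decidable-stable (escapes? w)
            (λ ¬esc → does-false (¬? (escapes? w) ×-dec (μ (w , h) ≟ d)) w∉ (¬esc , μw≡d))

        -- W contains y (by pinning, as d ≠ b) but not middle (it escapes via outer).
        y∈W : W y ≡ true
        y∈W = decided-true (¬? (escapes? y) ×-dec (μ (y , h) ≟ d))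
                       ((λ (z , yz , z∉) → d≢b (pinned sg gy yz z∉ h₁h)) , refl)

        middle∉W : W middle ≡ false
        middle∉W = decided-false (¬? (escapes? middle) ×-dec (μ (middle , h) ≟ d))
                             (λ (¬esc , _) → ¬esc (outer , middle~outer , outer∉))

        -- N²(W) avoids d: an escaping w' in N²(W) is pinned to b ≠ d.
        avoid-d : (p : TwoStepExit G W) → μ (TwoStepExit.outer p , h) ≢ d
        avoid-d (exitVia w x w' w∈ wx xw' w'∉) μw'≡d with W-escapes w'∉ μw'≡d
        ... | z , w'z , z∉ =
              d≢b (trans (≡-sym μw'≡d) (pinned (nbrs-in-s (proj₁ (W-sound w∈)) wx) xw' w'z z∉ h₁h))

        extremal : Extremal h₁ h W
        extremal = record
          { edge = h₁h ; a = d ; b = a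
          ; colour-a = λ w∈ → proj₂ (W-sound w∈)
          ; colour-b = λ w∈ wz → colour-a (nbrs-in-s (proj₁ (W-sound w∈)) wz)
          ; exit = twoStepExit nbip y∈W middle∉W
          ; avoid-a = avoid-d
          }

        -- W ⊊ N_G(s) (every vertex has a neighbour; middle ∉ W) and N_G(W) ⊆ s.
        shrinks : weight G W < weight G s
        shrinks = subst (weight G W <_) (+-comm (count (n G) (nbr G s)) (count (n G) s))
                        (+-mono-<-≤ W⊂nbr nbrW⊆s)
          where
            W⊆nbr : ∀ w → W w ≡ true → nbr G s w ≡ true
            W⊆nbr w w∈ with noIsolated G w
            ... | z , wz = nbr-intro G (nbrs-in-s (proj₁ (W-sound w∈)) wz) (adj-sym G wz)

            W⊂nbr : count (n G) W < count (n G) (nbr G s)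
            W⊂nbr = count-strict (n G) W⊆nbr middle middle∉W (nbr-intro G inner∈ inner~middle)

            nbrW⊆s : count (n G) (nbr G W) ≤ count (n G) s
            nbrW⊆s = count-mono (n G) λ v v∈ →
              let (x , x∈ , xv) = nbr-elim G v∈ in nbrs-in-s (proj₁ (W-sound x∈)) xv

      OffColour : ∀ {h₀ h₁ s} → Extremal h₀ h₁ s → Set
      OffColour {h₁ = h₁} {s} e =
        ∃ λ g → ∃ λ y → ∃ λ h → s g ≡ true × Adj G g y × Adj H h₁ h × μ (y , h) ≢ Extremal.b e

      offColour? : ∀ {h₀ h₁ s} (e : Extremal h₀ h₁ s) → Dec (OffColour e)
      offColour? {h₁ = h₁} {s} e =
        any? λ g → any? λ y → any? λ h → (s g ≟B true) ×-dec ((adj G g y ≟B true) ×-dec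
                                          ((adj H h₁ h ≟B true) ×-dec ¬? (μ (y , h) ≟ Extremal.b e)))

      improve : ∀ {h₀ h₁ s} → Acc _<_ (weight G s) → Extremal h₀ h₁ s → HImprovableByRecoloring G H K μ
      improve (acc smaller) e with offColour? e
      ... | yes (g , y , h , sg , gy , h₁h , d≢b) =
            improve (smaller (Descent.shrinks e sg gy h₁h d≢b)) (Descent.extremal e sg gy h₁h d≢b)
      ... | no none = Terminal.result e λ sg gy h₁h →
            decidable-stable (μ _ ≟ _) (λ ≢b → none (_ , _ , _ , sg , gy , h₁h , ≢b))

lemma15 : (G H K : Graph) (μ : VT G H → V K) →
    IsHom G H K μ → SquareFree K → Connected G → ¬ Bipartite G →
    HasHExtremalSet G H K μ → HImprovableByRecoloring G H K μ
lemma15 G H K μ hom sqf conn nbip (h₀ , h₁ , s , ext) =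
  improve hom sqf conn nbip (<-wellFounded _) (fromHExtremal ext)
  where open ExtremalSets G H K μ
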